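{- Let $c\ge1$ be a real constant. A Weyl-equivalence class of words in $\mathcal{M}$ contains a word of $\mathcal{M}_c$ if and only if it consists of rising words and its unique up-normal element lies in $\mathcal{M}_c$.
   Context: $\Bbbk$ is a field of characteristic $0$; $\mathcal{M}$ is the free monoid on letters $D,U$; $\mathcal{W}=\Bbbk\langle D,U\mid DU-UD=1\rangle$; $\phi:\mathcal{M}\to\mathcal{W}$ is the monoid morphism with $D\mapsto D,U\mapsto U$; words $u,v$ are Weyl-equivalent if $\phi(u)=\phi(v)$. For real $c>0$, $\mathcal{M}_c$ is the set of words every prefix of which contains at least $c$ times as many $U$'s as $D$'s. A word is rising if it has at least as many $U$'s as $D$'s. A down-zig is a word $UD^kU$ with $k\ge2$; a rising word is up-normal if it contains no down-zig as a contiguous factor. (Every Weyl-equivalence class of rising words contains exactly one up-normal word.) -}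

module Defs where

open import Data.Nat as ℕ using (ℕ; zero; suc; _+_; _*_; _∸_)
open import Data.Integer using (+_)
open import Data.Rational as ℚ using (ℚ; _/_; 1ℚ)
open import Data.List using (List; []; _∷_; _++_; replicate; foldl)
open import Data.Product using (Σ; ∃; _×_; _,_)
open import Data.Sum using (_⊎_)
open import Data.Empty using (⊥)
open import Relation.Nullary using (¬_)
open import Relation.Binary.PropositionalEquality using (_≡_)

record ℝ : Set₁ where
  field
    lower      : ℚ → Set          -- lower q  means  q < c
    upper      : ℚ → Set          -- upper q  means  c < q
    inhabitedL : ∃ lower
    inhabitedU : ∃ upper
    downL      : ∀ q r → q ℚ.< r → lower r → lower q
    roundedL   : ∀ q → lower q → ∃ λ r → (q ℚ.< r) × lower r
    upU        : ∀ q r → q ℚ.< r → upper q → upper r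
    roundedU   : ∀ q → upper q → ∃ λ r → (r ℚ.< q) × upper r
    disjoint   : ∀ q → lower q → upper q → ⊥
    located    : ∀ q r → q ℚ.< r → lower q ⊎ upper r

open ℝ public

ℕ→ℚ : ℕ → ℚ
ℕ→ℚ n = + n / 1

1≤ᵣ_ : ℝ → Set
1≤ᵣ c = ∀ q → q ℚ.< 1ℚ → lower c q

_·_≤ᵣ_ : ℝ → ℕ → ℕ → Set
c · d ≤ᵣ u = ∀ q → lower c q → q ℚ.* ℕ→ℚ d ℚ.≤ ℕ→ℚ u

data Letter : Set where
  D U : Letter

Word : Set
Word = List Letter

#U #D : Word → ℕ
#U []      = 0
#U (U ∷ w) = suc (#U w)
#U (D ∷ w) = #U w
#D []      = 0
#D (D ∷ w) = suc (#D w)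
#D (U ∷ w) = #D w

𝓜[_] : ℝ → Word → Set
𝓜[ c ] w = ∀ p s → p ++ s ≡ w → c · #D p ≤ᵣ #U p

Rising : Word → Set
Rising w = #D w ℕ.≤ #U w

downZig : ℕ → Word
downZig k = U ∷ replicate k D ++ U ∷ []

HasDownZig : Word → Set
HasDownZig w = ∃ λ k → (2 ℕ.≤ k) × ∃ λ a → ∃ λ b → w ≡ a ++ downZig k ++ b

UpNormal : Word → Set
UpNormal w = Rising w × ¬ HasDownZig w

-- The Weyl algebra 𝓦 = 𝕜⟨D,U | DU − UD = 1⟩, char 𝕜 = 0, realised by its
-- PBW basis: an element is Σ a_{ij} U^i D^j, stored as the coefficient
-- function (i , j) ↦ a_{ij}.  Images of words have coefficients in ℕ ⊆ 𝕜
-- (injective since char 𝕜 = 0).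

Wel : Set
Wel = ℕ → ℕ → ℕ

one : Wel
one zero zero = 1
one _    _    = 0

_·D : Wel → Wel
(f ·D) i zero    = 0
(f ·D) i (suc j) = f i j

-- right multiplication by U :  U^i D^j · U = U^(i+1) D^j + j U^i D^(j-1)
_·U : Wel → Wel
(f ·U) zero    j = suc j * f zero (suc j)
(f ·U) (suc i) j = f i j + suc j * f (suc i) (suc j)

stepφ : Wel → Letter → Wel
stepφ f D = f ·D
stepφ f U = f ·U

φ : Word → Wel
φ = foldl stepφ one

_∼W_ : Word → Word → Set
u ∼W v = ∀ i j → φ u i j ≡ φ v i j

{-# OPTIONS --safe #-}
module Submission where

-- In 𝓦 the relation DU = UD + 1 gives UD·w − w·UD = (#U w − #D w)·w for every word w, so DU
-- commutes with every word having as many U's as D's.  Reading a word of 𝓜_c from the left, one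
-- maintains an equivalent word Y Dᵏ of 𝓜_c in which Y is a product of factors U and UD, hence
-- free of down-zigs: a letter D raises k, a letter U extends Y when k = 0, and otherwise
-- x U z Dᵏ · U = x U z Dᵏ⁻¹ · DU ∼ x U · DU · z Dᵏ⁻¹ with z Dᵏ⁻¹ balanced.  The prefixes that
-- this last move changes lose some D's and at most as many U's, so they stay in 𝓜_c as c ≥ 1.
-- Finally φ w has a nonzero coefficient at U^#U(w) D^#D(w) and none beyond it, so equivalent
-- words have the same letter counts; hence the class of a word of 𝓜_c consists of rising words.

open import Defs
open import Data.Product using (∃; _×_)
open import Function.Bundles using (_⇔_)

open import Data.Empty using (⊥)
open import Data.Integer as ℤ using (+_; +≤+; +<+)
import Data.Integer.Properties as ℤ
open import Data.List using (List; []; _∷_; _++_; replicate; foldl; _∷ʳ_)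
open import Data.List.Properties using (foldl-++; ++-assoc; ++-identityʳ; ∷-injective; ∷-injectiveʳ; ∷ʳ-++)
open import Data.List.Relation.Unary.All using (All; []; _∷_)
open import Data.List.Relation.Unary.All.Properties using (++⁻ˡ; ++⁻ʳ; replicate⁺)
open import Data.List.Reverse using (Reverse; []; _∶_∶ʳ_; reverseView)
open import Data.Nat using (ℕ; zero; suc; _+_; _*_; _≤_; _<_; z≤n; s≤s; z<s; s≤s⁻¹; s<s⁻¹; _≤?_)
open import Data.Nat.Properties
open import Algebra.Properties.CommutativeSemigroup +-commutativeSemigroup
  using (interchange; x∙yz≈y∙xz; xy∙z≈xz∙y; xy∙z≈x∙zy)
open import Data.Nat.Tactic.RingSolver using (solve-∀)
open import Data.Product using (∃₂; _,_; proj₁; proj₂)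
open import Data.Rational as ℚ using (mkℚ; 1ℚ; toℚᵘ; fromℚᵘ)
import Data.Rational.Properties as ℚ
open import Data.Rational.Unnormalised as ℚᵘ using (ℚᵘ; mkℚᵘ; *≤*; *<*)
import Data.Rational.Unnormalised.Properties as ℚᵘ
open import Data.Sum as Sum using (_⊎_; inj₁; inj₂)
open import Function using (id; _∘_; _∘₂_)
open import Function.Bundles using (mk⇔; Equivalence)
open import Relation.Nullary using (¬_; yes; no)
open import Relation.Binary.PropositionalEquality

variable
  c : ℝ
  f g : Wel
  a b k : ℕ
  u v w x y z : Word

infix  4 _≈_
infixl 6 _⊕_

_≈_ : Wel → Wel → Set
f ≈ g = ∀ i j → f i j ≡ g i j

_⊕_ : Wel → Wel → Wel
(f ⊕ g) i j = f i j + g i j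

act : Word → Wel → Wel
act w f = foldl stepφ f w

act-++ : ∀ u w f → act (u ++ w) f ≈ act w (act u f)
act-++ u w f i j = cong (λ h → h i j) (foldl-++ stepφ f u w)

·U-cong : f ≈ g → f ·U ≈ g ·U
·U-cong f≈g zero    j = cong (suc j *_) (f≈g zero (suc j))
·U-cong f≈g (suc i) j = cong₂ (λ x y → x + suc j * y) (f≈g i j) (f≈g (suc i) (suc j))

·D-cong : f ≈ g → f ·D ≈ g ·D
·D-cong f≈g i zero    = refl
·D-cong f≈g i (suc j) = f≈g i j

act-cong : ∀ w → f ≈ g → act w f ≈ act w g
act-cong []      f≈g = f≈g
act-cong (U ∷ w) f≈g = act-cong w (·U-cong f≈g)
act-cong (D ∷ w) f≈g = act-cong w (·D-cong f≈g)

·U-⊕ : (f ⊕ g) ·U ≈ f ·U ⊕ g ·U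
·U-⊕ {f} {g} zero    j = *-distribˡ-+ (suc j) (f zero (suc j)) (g zero (suc j))
·U-⊕ {f} {g} (suc i) j = distrib (f i j) (g i j) (f (suc i) (suc j)) (g (suc i) (suc j)) (suc j)
  where
  distrib : ∀ a b c d s → (a + b) + s * (c + d) ≡ (a + s * c) + (b + s * d)
  distrib = solve-∀

·D-⊕ : (f ⊕ g) ·D ≈ f ·D ⊕ g ·D
·D-⊕ i zero    = refl
·D-⊕ i (suc j) = refl

act-⊕ : ∀ w → act w (f ⊕ g) ≈ act w f ⊕ act w g
act-⊕ []      i j = refl
act-⊕ (U ∷ w) i j = trans (act-cong w ·U-⊕ i j) (act-⊕ w i j)
act-⊕ (D ∷ w) i j = trans (act-cong w ·D-⊕ i j) (act-⊕ w i j)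

Θ : Wel → Wel
Θ f = (f ·U) ·D

DU≈UD+1 : (f ·D) ·U ≈ Θ f ⊕ f
DU≈UD+1     zero    zero    = +-identityʳ _
DU≈UD+1 {f} zero    (suc j) = +-comm (f zero (suc j)) _
DU≈UD+1     (suc i) zero    = +-identityʳ _
DU≈UD+1 {f} (suc i) (suc j) = expand (f i j) (f (suc i) (suc j)) j
  where
  expand : ∀ a b j → a + suc (suc j) * b ≡ (a + suc j * b) + b
  expand = solve-∀

Θ-·U : (Θ f) ·U ≈ Θ (f ·U) ⊕ f ·U
Θ-·U = DU≈UD+1

Θ-·D : Θ (f ·D) ≈ (Θ f) ·D ⊕ f ·D
Θ-·D i j = trans (·D-cong DU≈UD+1 i j) (·D-⊕ i j)

-- UD·w − w·UD = (#U w − #D w)·w in 𝓦, with both sides moved so that no subtraction occurs.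
act-Θ-commutator : ∀ w f i j →
                   act w (Θ f) i j + #D w * act w f i j ≡ Θ (act w f) i j + #U w * act w f i j
act-Θ-commutator []      f i j = refl
act-Θ-commutator (U ∷ w) f i j = begin
  act w (Θ f ·U) i j + #D w * G            ≡⟨ cong (_+ #D w * G) (trans (act-cong w Θ-·U i j) (act-⊕ w i j)) ⟩
  act w (Θ (f ·U)) i j + G + #D w * G      ≡⟨ xy∙z≈xz∙y (act w (Θ (f ·U)) i j) G (#D w * G) ⟩
  act w (Θ (f ·U)) i j + #D w * G + G      ≡⟨ cong (_+ G) (act-Θ-commutator w (f ·U) i j) ⟩
  Θ (act w (f ·U)) i j + #U w * G + G      ≡⟨ xy∙z≈x∙zy (Θ (act w (f ·U)) i j) (#U w * G) G ⟩
  Θ (act w (f ·U)) i j + (G + #U w * G)    ∎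
  where
  open ≡-Reasoning
  G = act w (f ·U) i j
act-Θ-commutator (D ∷ w) f i j = begin
  act w (Θ f ·D) i j + (G + #D w * G)      ≡⟨ +-assoc (act w (Θ f ·D) i j) G (#D w * G) ⟨
  act w (Θ f ·D) i j + G + #D w * G        ≡⟨ cong (_+ #D w * G) (trans (act-cong w Θ-·D i j) (act-⊕ w i j)) ⟨
  act w (Θ (f ·D)) i j + #D w * G          ≡⟨ act-Θ-commutator w (f ·D) i j ⟩
  Θ (act w (f ·D)) i j + #U w * G          ∎
  where
  open ≡-Reasoning
  G = act w (f ·D) i j

act-Θ-balanced : ∀ w f → #U w ≡ #D w → act w (Θ f) ≈ Θ (act w f)
act-Θ-balanced w f #U≡#D i j =
  +-cancelʳ-≡ (#D w * act w f i j) _ _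
    (trans (act-Θ-commutator w f i j) (cong (λ n → Θ (act w f) i j + n * act w f i j) #U≡#D))

act-DU-balanced : ∀ w f → #U w ≡ #D w → act (D ∷ U ∷ w) f ≈ act (w ++ D ∷ U ∷ []) f
act-DU-balanced w f #U≡#D i j = begin
  act w ((f ·D) ·U) i j               ≡⟨ trans (act-cong w DU≈UD+1 i j) (act-⊕ w i j) ⟩
  act w (Θ f) i j + act w f i j       ≡⟨ cong (_+ act w f i j) (act-Θ-balanced w f #U≡#D i j) ⟩
  Θ (act w f) i j + act w f i j       ≡⟨ DU≈UD+1 i j ⟨
  ((act w f ·D) ·U) i j               ≡⟨ act-++ w (D ∷ U ∷ []) f i j ⟨
  act (w ++ D ∷ U ∷ []) f i j         ∎
  where open ≡-Reasoning

∼W-++ʳ : ∀ w → u ∼W v → (u ++ w) ∼W (v ++ w)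
∼W-++ʳ {u} {v} w u∼v i j =
  trans (act-++ u w one i j) (trans (act-cong w u∼v i j) (sym (act-++ v w one i j)))

∼W-DU-balanced : ∀ u w → #U w ≡ #D w → (u ++ D ∷ U ∷ w) ∼W (u ++ w ++ D ∷ U ∷ [])
∼W-DU-balanced u w #U≡#D i j =
  trans (act-++ u (D ∷ U ∷ w) one i j)
        (trans (act-DU-balanced w (φ u) #U≡#D i j) (sym (act-++ u (w ++ D ∷ U ∷ []) one i j)))

Supported : Wel → ℕ → ℕ → Set
Supported f a b = ∀ i j → a < i ⊎ b < j → f i j ≡ 0

·U-supported : Supported f a b → Supported (f ·U) (suc a) b
·U-supported sup zero    j (inj₂ b<j) =
  trans (cong (suc j *_) (sup zero (suc j) (inj₂ (m<n⇒m<1+n b<j)))) (*-zeroʳ (suc j))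
·U-supported sup (suc i) j out =
  trans (cong₂ (λ x y → x + suc j * y)
               (sup i j (Sum.map s<s⁻¹ id out))
               (sup (suc i) (suc j) (Sum.map (m<n⇒m<1+n ∘ s<s⁻¹) m<n⇒m<1+n out)))
        (*-zeroʳ (suc j))

·D-supported : Supported f a b → Supported (f ·D) a (suc b)
·D-supported sup i zero    out = refl
·D-supported sup i (suc j) out = sup i j (Sum.map id s<s⁻¹ out)

act-supported : ∀ w → Supported f a b → Supported (act w f) (#U w + a) (#D w + b)
act-supported             []      sup = sup
act-supported {f} {a} {b} (U ∷ w) sup =
  subst (λ n → Supported (act w (f ·U)) n (#D w + b)) (+-suc (#U w) a) (act-supported w (·U-supported sup))
act-supported {f} {a} {b} (D ∷ w) sup =
  subst (Supported (act w (f ·D)) (#U w + a)) (+-suc (#D w) b) (act-supported w (·D-supported sup))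

one-supported : Supported one 0 0
one-supported zero    zero    (inj₁ ())
one-supported zero    zero    (inj₂ ())
one-supported zero    (suc j) out = refl
one-supported (suc i) j       out = refl

φ-supported : ∀ w → Supported (φ w) (#U w) (#D w)
φ-supported w =
  subst₂ (Supported (φ w)) (+-identityʳ (#U w)) (+-identityʳ (#D w)) (act-supported w one-supported)

act-top : ∀ w → 0 < f a b → 0 < act w f (#U w + a) (#D w + b)
act-top             []      pos = pos
act-top {f} {a} {b} (U ∷ w) pos =
  subst (λ n → 0 < act w (f ·U) n (#D w + b)) (+-suc (#U w) a)
        (act-top w (<-≤-trans pos (m≤m+n (f a b) _)))
act-top {f} {a} {b} (D ∷ w) pos =
  subst (λ n → 0 < act w (f ·D) (#U w + a) n) (+-suc (#D w) b) (act-top w pos)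

φ-top : ∀ w → 0 < φ w (#U w) (#D w)
φ-top w = subst₂ (λ i j → 0 < φ w i j) (+-identityʳ (#U w)) (+-identityʳ (#D w)) (act-top w z<s)

∼W-counts≤ : u ∼W v → #U u ≤ #U v × #D u ≤ #D v
∼W-counts≤ {u} {v} u∼v = ≮⇒≥ (outside ∘ inj₁) , ≮⇒≥ (outside ∘ inj₂)
  where
  outside : #U v < #U u ⊎ #D v < #D u → ⊥
  outside out = <-irrefl (sym (trans (u∼v _ _) (φ-supported v _ _ out))) (φ-top u)

∼W-#U : u ∼W v → #U u ≡ #U v
∼W-#U {u} {v} u∼v = ≤-antisym (proj₁ (∼W-counts≤ {u} {v} u∼v)) (proj₁ (∼W-counts≤ {v} {u} (sym ∘₂ u∼v)))

∼W-#D : u ∼W v → #D u ≡ #D v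
∼W-#D {u} {v} u∼v = ≤-antisym (proj₂ (∼W-counts≤ {u} {v} u∼v)) (proj₂ (∼W-counts≤ {v} {u} (sym ∘₂ u∼v)))

ℕ→ℚᵘ : ℕ → ℚᵘ
ℕ→ℚᵘ n = mkℚᵘ (+ n) 0

*ℕ≤ℕ⇔toℚᵘ : ∀ q d u → (q ℚ.* ℕ→ℚ d ℚ.≤ ℕ→ℚ u) ⇔ (toℚᵘ q ℚᵘ.* ℕ→ℚᵘ d ℚᵘ.≤ ℕ→ℚᵘ u)
*ℕ≤ℕ⇔toℚᵘ q d u = mk⇔
  (λ h → ℚᵘ.≤-respʳ-≃ (toℚᵘ-ℕ→ℚ u) (ℚᵘ.≤-respˡ-≃ toℚᵘ-q*d (ℚ.toℚᵘ-mono-≤ h)))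
  (λ h → ℚ.toℚᵘ-cancel-≤ (ℚᵘ.≤-respʳ-≃ (ℚᵘ.≃-sym (toℚᵘ-ℕ→ℚ u)) (ℚᵘ.≤-respˡ-≃ (ℚᵘ.≃-sym toℚᵘ-q*d) h)))
  where
  toℚᵘ-ℕ→ℚ : ∀ n → toℚᵘ (ℕ→ℚ n) ℚᵘ.≃ ℕ→ℚᵘ n
  toℚᵘ-ℕ→ℚ n = ℚ.toℚᵘ-fromℚᵘ (ℕ→ℚᵘ n)
  toℚᵘ-q*d : toℚᵘ (q ℚ.* ℕ→ℚ d) ℚᵘ.≃ toℚᵘ q ℚᵘ.* ℕ→ℚᵘ d
  toℚᵘ-q*d = ℚᵘ.≃-trans (ℚ.toℚᵘ-homo-* q (ℕ→ℚ d)) (ℚᵘ.*-congˡ {toℚᵘ q} (toℚᵘ-ℕ→ℚ d))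

mkℚᵘ*ℕ≤ℕ⇔ : ∀ a b d u → (mkℚᵘ a b ℚᵘ.* ℕ→ℚᵘ d ℚᵘ.≤ ℕ→ℚᵘ u) ⇔ (a ℤ.* + d ℤ.≤ + u ℤ.* + suc b)
mkℚᵘ*ℕ≤ℕ⇔ a b d u = mk⇔
  (λ { (*≤* h) → subst₂ ℤ._≤_ (ℤ.*-identityʳ _) (cong (λ n → + u ℤ.* + suc n) (*-identityʳ b)) h })
  (λ h → *≤* (subst₂ ℤ._≤_ (sym (ℤ.*-identityʳ _)) (cong (λ n → + u ℤ.* + suc n) (sym (*-identityʳ b))) h))

pos-*-≤⇔ : ∀ a b c d → (+ a ℤ.* + b ℤ.≤ + c ℤ.* + d) ⇔ (a * b ≤ c * d)
pos-*-≤⇔ a b c d = mk⇔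
  (λ h → ℤ.drop‿+≤+ (subst₂ ℤ._≤_ (sym (ℤ.pos-* a b)) (sym (ℤ.pos-* c d)) h))
  (λ h → subst₂ ℤ._≤_ (ℤ.pos-* a b) (ℤ.pos-* c d) (+≤+ h))

·≤ᵣ⇒≤ : ∀ {c d u} → 1≤ᵣ c → c · d ≤ᵣ u → d ≤ u
·≤ᵣ⇒≤ {c} {d} {u} 1≤c c·d≤u = ≮⇒≥ u≮d
  where
  -- The witness q = (u+1)/(u+2) lies below 1, yet q · (u+1) > u.
  X : ℚᵘ
  X = mkℚᵘ (+ suc u) (suc u)
  q<1 : fromℚᵘ X ℚ.< 1ℚ
  q<1 = ℚ.toℚᵘ-cancel-< (ℚᵘ.<-respˡ-≃ (ℚᵘ.≃-sym (ℚ.toℚᵘ-fromℚᵘ X))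
          (*<* (subst₂ ℤ._<_ (ℤ.pos-* (suc u) 1) (ℤ.pos-* 1 (suc (suc u)))
                 (+<+ (subst₂ _<_ (sym (*-identityʳ (suc u))) (sym (*-identityˡ (suc (suc u)))) ≤-refl)))))
  q·d≤u : suc u * d ≤ u * suc (suc u)
  q·d≤u = Equivalence.to (pos-*-≤⇔ (suc u) d u (suc (suc u)))
            (Equivalence.to (mkℚᵘ*ℕ≤ℕ⇔ (+ suc u) (suc u) d u)
              (ℚᵘ.≤-respˡ-≃ (ℚᵘ.*-congʳ (ℚ.toℚᵘ-fromℚᵘ X))
                (Equivalence.to (*ℕ≤ℕ⇔toℚᵘ (fromℚᵘ X) d u) (c·d≤u (fromℚᵘ X) (1≤c (fromℚᵘ X) q<1)))))
  square : ∀ u → suc u * suc u ≡ suc (u * suc (suc u))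
  square = solve-∀
  u≮d : ¬ (u < d)
  u≮d u<d = <-irrefl refl (begin-strict
    u * suc (suc u)          <⟨ n<1+n _ ⟩
    suc (u * suc (suc u))    ≡⟨ square u ⟨
    suc u * suc u            ≤⟨ *-monoʳ-≤ (suc u) u<d ⟩
    suc u * d                ≤⟨ q·d≤u ⟩
    u * suc (suc u)          ∎)
    where open ≤-Reasoning

fraction≥1-shrink : ∀ {a b d m n u} → a * m ≤ n * b → b ≤ a → d ≤ m → d + n ≤ u + m → a * d ≤ u * b
fraction≥1-shrink {a} {b} {d} {m} {n} {u} am≤nb b≤a d≤m dn≤um with m≤n⇒∃[o]m+o≡n d≤m
... | e , refl = +-cancelʳ-≤ (b * e) (a * d) (u * b) (begin
    a * d + b * e    ≤⟨ +-monoʳ-≤ (a * d) (*-monoˡ-≤ e b≤a) ⟩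
    a * d + a * e    ≡⟨ *-distribˡ-+ a d e ⟨
    a * (d + e)      ≤⟨ am≤nb ⟩
    n * b            ≤⟨ *-monoˡ-≤ b n≤u+e ⟩
    (u + e) * b      ≡⟨ trans (*-distribʳ-+ b u e) (cong (_+_ (u * b)) (*-comm e b)) ⟩
    u * b + b * e    ∎)
  where
  open ≤-Reasoning
  n≤u+e : n ≤ u + e
  n≤u+e = +-cancelˡ-≤ d n (u + e) (≤-trans dn≤um (≤-reflexive (x∙yz≈y∙xz u d e)))

fraction-shrink : ∀ a b {d m n u} → a ℤ.* + m ℤ.≤ + n ℤ.* + suc b → d ≤ u → d ≤ m → d + n ≤ u + m →
                  a ℤ.* + d ℤ.≤ + u ℤ.* + suc b
fraction-shrink a b {d} {u = u} _ d≤u _ _ with ℤ.≤-total a (+ suc b)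
... | inj₁ a≤b = ℤ.≤-trans (ℤ.*-monoʳ-≤-nonNeg (+ d) a≤b)
                   (ℤ.≤-trans (ℤ.*-monoˡ-≤-nonNeg (+ suc b) (+≤+ d≤u)) (ℤ.≤-reflexive (ℤ.*-comm (+ suc b) (+ u))))
fraction-shrink (+ a) b {d} {m} {n} {u} am≤nb _ d≤m dn≤um | inj₂ (+≤+ b≤a) =
  Equivalence.from (pos-*-≤⇔ a d u (suc b))
    (fraction≥1-shrink (Equivalence.to (pos-*-≤⇔ a m n (suc b)) am≤nb) b≤a d≤m dn≤um)

·≤ᵣ-shrink : ∀ {c d m n u} → 1≤ᵣ c → c · m ≤ᵣ n → d ≤ m → d + n ≤ u + m → c · d ≤ᵣ u
·≤ᵣ-shrink {c} {d} {m} {n} {u} 1≤c c·m≤n d≤m dn≤um q@(mkℚ a b _) q<c =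
  Equivalence.from (*ℕ≤ℕ⇔toℚᵘ q d u)
    (Equivalence.from (mkℚᵘ*ℕ≤ℕ⇔ a b d u) (fraction-shrink a b am≤nb d≤u d≤m dn≤um))
  where
  am≤nb : a ℤ.* + m ℤ.≤ + n ℤ.* + suc b
  am≤nb = Equivalence.to (mkℚᵘ*ℕ≤ℕ⇔ a b m n) (Equivalence.to (*ℕ≤ℕ⇔toℚᵘ q m n) (c·m≤n q q<c))
  d≤u : d ≤ u
  d≤u = +-cancelʳ-≤ n d u (≤-trans dn≤um (+-monoʳ-≤ u (·≤ᵣ⇒≤ {c} {m} {n} 1≤c c·m≤n)))

#U-++ : ∀ u w → #U (u ++ w) ≡ #U u + #U w
#U-++ []      w = refl
#U-++ (U ∷ u) w = cong suc (#U-++ u w)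
#U-++ (D ∷ u) w = #U-++ u w

#D-++ : ∀ u w → #D (u ++ w) ≡ #D u + #D w
#D-++ []      w = refl
#D-++ (U ∷ u) w = #D-++ u w
#D-++ (D ∷ u) w = cong suc (#D-++ u w)

#U-replicate-D : ∀ k → #U (replicate k D) ≡ 0
#U-replicate-D zero    = refl
#U-replicate-D (suc k) = #U-replicate-D k

#D-replicate-D : ∀ k → #D (replicate k D) ≡ k
#D-replicate-D zero    = refl
#D-replicate-D (suc k) = cong suc (#D-replicate-D k)

#U-++-replicate-D : ∀ y k → #U (y ++ replicate k D) ≡ #U y
#U-++-replicate-D y k = trans (#U-++ y _) (trans (cong (_+_ (#U y)) (#U-replicate-D k)) (+-identityʳ (#U y)))

#D-++-replicate-D : ∀ y k → #D (y ++ replicate k D) ≡ #D y + k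
#D-++-replicate-D y k = trans (#D-++ y _) (cong (_+_ (#D y)) (#D-replicate-D k))

replicate-∷ʳ : ∀ k (l : Letter) → replicate k l ∷ʳ l ≡ l ∷ replicate k l
replicate-∷ʳ zero    l = refl
replicate-∷ʳ (suc k) l = cong (l ∷_) (replicate-∷ʳ k l)

++-split : ∀ {A : Set} (u w p s : List A) → p ++ s ≡ u ++ w →
           (∃ λ t → p ++ t ≡ u) ⊎ (∃ λ q → p ≡ u ++ q × q ++ s ≡ w)
++-split []      w p       s eq = inj₂ (p , refl , eq)
++-split (l ∷ u) w []      s eq = inj₁ (l ∷ u , refl)
++-split (l ∷ u) w (m ∷ p) s eq with refl , eq′ ← ∷-injective eq with ++-split u w p s eq′
... | inj₁ (t , p++t≡u)        = inj₁ (t , cong (l ∷_) p++t≡u)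
... | inj₂ (q , refl , q++s≡w) = inj₂ (q , refl , q++s≡w)

prefix-#D≤ : ∀ p s → p ++ s ≡ w → #D p ≤ #D w
prefix-#D≤ p s refl = subst (#D p ≤_) (sym (#D-++ p s)) (m≤m+n (#D p) (#D s))

Rising[_] : ℝ → Word → Set
Rising[ c ] w = c · #D w ≤ᵣ #U w

Rising[]⇒Rising : 1≤ᵣ c → Rising[ c ] w → Rising w
Rising[]⇒Rising {c} {w} = ·≤ᵣ⇒≤ {c} {#D w} {#U w}

Rising[]-∼W : u ∼W v → Rising[ c ] u → Rising[ c ] v
Rising[]-∼W {u} {v} {c} u∼v = subst₂ (c ·_≤ᵣ_) (∼W-#D {u} {v} u∼v) (∼W-#U {u} {v} u∼v)

Rising[]-shrink : ∀ u → 1≤ᵣ c → Rising[ c ] (u ++ x) → #D y ≤ #D x → #D y + #U x ≤ #U y + #D x →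
                  Rising[ c ] (u ++ y)
Rising[]-shrink {c} {x} {y} u 1≤c r #Dy≤#Dx excess =
  subst₂ (c ·_≤ᵣ_) (sym (#D-++ u y)) (sym (#U-++ u y))
    (·≤ᵣ-shrink {c} {#D u + #D y} {#D u + #D x} {#U u + #U x} {#U u + #U y} 1≤c
      (subst₂ (c ·_≤ᵣ_) (#D-++ u x) (#U-++ u x) r) (+-monoʳ-≤ (#D u) #Dy≤#Dx) excess′)
  where
  open ≤-Reasoning
  excess′ : (#D u + #D y) + (#U u + #U x) ≤ (#U u + #U y) + (#D u + #D x)
  excess′ = begin
    (#D u + #D y) + (#U u + #U x)    ≡⟨ interchange (#D u) (#D y) (#U u) (#U x) ⟩
    (#D u + #U u) + (#D y + #U x)    ≤⟨ +-monoʳ-≤ (#D u + #U u) excess ⟩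
    (#D u + #U u) + (#U y + #D x)    ≡⟨ cong (_+ (#U y + #D x)) (+-comm (#D u) (#U u)) ⟩
    (#U u + #D u) + (#U y + #D x)    ≡⟨ interchange (#U u) (#D u) (#U y) (#D x) ⟩
    (#U u + #U y) + (#D u + #D x)    ∎

𝓜-++⁻ˡ : ∀ u → 𝓜[ c ] (u ++ w) → 𝓜[ c ] u
𝓜-++⁻ˡ {w = w} u m p s refl = m p (s ++ w) (sym (++-assoc p s w))

𝓜⇒Rising[] : ∀ w → 𝓜[ c ] w → Rising[ c ] w
𝓜⇒Rising[] w m = m w [] (++-identityʳ w)

𝓜-∷ʳ : ∀ w l → 𝓜[ c ] w → Rising[ c ] (w ∷ʳ l) → 𝓜[ c ] (w ∷ʳ l)
𝓜-∷ʳ w l m r p s eq with ++-split w (l ∷ []) p s eq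
... | inj₁ (t , p++t≡w)           = m p t p++t≡w
... | inj₂ ([]     , refl , _)    = m (w ++ []) [] (trans (++-identityʳ _) (++-identityʳ w))
... | inj₂ (_ ∷ [] , refl , refl) = r

𝓜-∼W-Rising : 1≤ᵣ c → ∀ v → 𝓜[ c ] v → ∀ u → v ∼W u → Rising u
𝓜-∼W-Rising {c} 1≤c v mv u v∼u =
  subst₂ _≤_ (∼W-#D {v} {u} v∼u) (∼W-#U {v} {u} v∼u) (Rising[]⇒Rising {c} {v} 1≤c (𝓜⇒Rising[] {c} v mv))

Represents : ℝ → Word → Word → Set
Represents c v w = w ∼W v × 𝓜[ c ] w

Represents-∷ʳ : ∀ l → Represents c v w → 𝓜[ c ] (v ∷ʳ l) → Represents c (v ∷ʳ l) (w ∷ʳ l)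
Represents-∷ʳ {c} {v} {w} l (w∼v , m) mvl =
  wl∼vl , 𝓜-∷ʳ {c} w l m (Rising[]-∼W {v ∷ʳ l} {w ∷ʳ l} {c} (λ i j → sym (wl∼vl i j)) (𝓜⇒Rising[] {c} (v ∷ʳ l) mvl))
  where
  wl∼vl : (w ∷ʳ l) ∼W (v ∷ʳ l)
  wl∼vl = ∼W-++ʳ {w} {v} (l ∷ []) w∼v

PrefixRising : Word → Set
PrefixRising w = ∀ p s → p ++ s ≡ w → Rising p

PrefixRising-++-replicate-D : PrefixRising z → #D z + k ≤ #U z → PrefixRising (z ++ replicate k D)
PrefixRising-++-replicate-D {z} {k} pz excess p s eq with ++-split z (replicate k D) p s eq
... | inj₁ (t , p++t≡z)         = pz p t p++t≡z
... | inj₂ (q , refl , q++s≡Dᵏ) = begin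
  #D (z ++ q)    ≡⟨ #D-++ z q ⟩
  #D z + #D q    ≤⟨ +-monoʳ-≤ (#D z) (subst (#D q ≤_) (#D-replicate-D k) (prefix-#D≤ q s q++s≡Dᵏ)) ⟩
  #D z + k       ≤⟨ excess ⟩
  #U z           ≤⟨ m≤m+n (#U z) (#U q) ⟩
  #U z + #U q    ≡⟨ #U-++ z q ⟨
  #U (z ++ q)    ∎
  where open ≤-Reasoning

DU∷-prefix-#D≤ : PrefixRising z → ∀ p s → p ++ s ≡ D ∷ U ∷ z → #D p ≤ suc (#U p)
DU∷-prefix-#D≤ pz []          s eq = z≤n
DU∷-prefix-#D≤ pz (D ∷ [])    s eq = s≤s z≤n
DU∷-prefix-#D≤ pz (D ∷ U ∷ p) s eq = s≤s (m≤n⇒m≤1+n (pz p s (∷-injectiveʳ (∷-injectiveʳ eq))))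
DU∷-prefix-#D≤ pz (D ∷ D ∷ p) s ()
DU∷-prefix-#D≤ pz (U ∷ p)     s ()

𝓜-DU-insert : ∀ u z → 1≤ᵣ c → PrefixRising z → #U z ≡ #D z →
              𝓜[ c ] (u ++ z ++ D ∷ []) → 𝓜[ c ] (u ++ D ∷ U ∷ z)
𝓜-DU-insert {c} u z 1≤c pz balanced m p s eq with ++-split u (D ∷ U ∷ z) p s eq
... | inj₁ (t , p++t≡u) = m p (t ++ z ++ D ∷ []) (trans (sym (++-assoc p t _)) (cong (_++ z ++ D ∷ []) p++t≡u))
... | inj₂ (q , refl , q++s≡DUz) =
  Rising[]-shrink {c} {z ++ D ∷ []} {q} u 1≤c (𝓜⇒Rising[] {c} (u ++ z ++ D ∷ []) m) #Dq≤ excess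
  where
  #D[zD] : #D (z ++ D ∷ []) ≡ suc (#D z)
  #D[zD] = trans (#D-++ z (D ∷ [])) (+-comm (#D z) 1)
  #U[zD] : #U (z ++ D ∷ []) ≡ #D z
  #U[zD] = trans (#U-++ z (D ∷ [])) (trans (+-identityʳ (#U z)) balanced)
  #Dq≤ : #D q ≤ #D (z ++ D ∷ [])
  #Dq≤ = subst (#D q ≤_) (sym #D[zD]) (prefix-#D≤ q s q++s≡DUz)
  excess : #D q + #U (z ++ D ∷ []) ≤ #U q + #D (z ++ D ∷ [])
  excess = begin
    #D q + #U (z ++ D ∷ [])    ≡⟨ cong (_+_ (#D q)) #U[zD] ⟩
    #D q + #D z                ≤⟨ +-monoˡ-≤ (#D z) (DU∷-prefix-#D≤ pz q s q++s≡DUz) ⟩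
    suc (#U q + #D z)          ≡⟨ +-suc (#U q) (#D z) ⟨
    #U q + suc (#D z)          ≡⟨ cong (_+_ (#U q)) #D[zD] ⟨
    #U q + #D (z ++ D ∷ [])    ∎
    where open ≤-Reasoning

data Tokens : Word → Set where
  []   : Tokens []
  U∷_  : Tokens y → Tokens (U ∷ y)
  UD∷_ : Tokens y → Tokens (U ∷ D ∷ y)

Tokens-++ : Tokens x → Tokens y → Tokens (x ++ y)
Tokens-++ []       ty = ty
Tokens-++ (U∷ tx)  ty = U∷ Tokens-++ tx ty
Tokens-++ (UD∷ tx) ty = UD∷ Tokens-++ tx ty

Tokens⇒PrefixRising : Tokens y → PrefixRising y
Tokens⇒PrefixRising ty       []          s eq = z≤n
Tokens⇒PrefixRising (U∷ ty)  (U ∷ p)     s eq = m≤n⇒m≤1+n (Tokens⇒PrefixRising ty p s (∷-injectiveʳ eq))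
Tokens⇒PrefixRising (UD∷ ty) (U ∷ [])    s eq = z≤n
Tokens⇒PrefixRising (UD∷ ty) (U ∷ D ∷ p) s eq = s≤s (Tokens⇒PrefixRising ty p s (∷-injectiveʳ (∷-injectiveʳ eq)))
Tokens⇒PrefixRising (UD∷ ty) (U ∷ U ∷ p) s ()
Tokens⇒PrefixRising []       (_ ∷ p)     s ()
Tokens⇒PrefixRising (U∷ ty)  (D ∷ p)     s ()
Tokens⇒PrefixRising (UD∷ ty) (D ∷ p)     s ()

Tokens-split : Tokens y → #D y + suc k ≤ #U y →
               ∃₂ λ x z → y ≡ x ++ U ∷ z × Tokens x × Tokens z × #U z ≡ #D z + k
Tokens-split {k = k} (U∷_ {y} ty) excess with #D y + suc k ≤? #U y
... | yes excess′ with x , z , refl , tx , tz , balance ← Tokens-split ty excess′ =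
  U ∷ x , z , refl , U∷ tx , tz , balance
... | no ¬excess′ = [] , y , refl , [] , ty , ≤-antisym
  (s≤s⁻¹ (subst (suc (#U y) ≤_) (+-suc (#D y) k) (≰⇒> ¬excess′)))
  (s≤s⁻¹ (subst (_≤ suc (#U y)) (+-suc (#D y) k) excess))
Tokens-split (UD∷ ty) excess with x , z , refl , tx , tz , balance ← Tokens-split ty (s≤s⁻¹ excess) =
  U ∷ D ∷ x , z , refl , UD∷ tx , tz , balance

replicate-D-suffix : ∀ k p t → replicate k D ≡ p ++ t → All (D ≡_) t
replicate-D-suffix k p t eq = ++⁻ʳ p (subst (All (D ≡_)) eq (replicate⁺ k refl))

Tokens-UDD-suffix : Tokens y → ∀ k p t → y ++ replicate k D ≡ p ++ U ∷ D ∷ D ∷ t → All (D ≡_) t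
Tokens-UDD-suffix []            k p           t eq with _ ∷ _ ∷ _ ∷ ds ← replicate-D-suffix k p _ eq = ds
Tokens-UDD-suffix (U∷ [])       k []          t eq = replicate-D-suffix k (D ∷ D ∷ []) t (∷-injectiveʳ eq)
Tokens-UDD-suffix (U∷ (U∷ _))   k []          t ()
Tokens-UDD-suffix (U∷ (UD∷ _))  k []          t ()
Tokens-UDD-suffix (U∷ ty)       k (_ ∷ p)     t eq = Tokens-UDD-suffix ty k p t (∷-injectiveʳ eq)
Tokens-UDD-suffix (UD∷ [])      k []          t eq =
  replicate-D-suffix k (D ∷ []) t (∷-injectiveʳ (∷-injectiveʳ eq))
Tokens-UDD-suffix (UD∷ (U∷ _))  k []          t ()
Tokens-UDD-suffix (UD∷ (UD∷ _)) k []          t ()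
Tokens-UDD-suffix (UD∷ ty)      k (_ ∷ [])    t ()
Tokens-UDD-suffix (UD∷ ty)      k (_ ∷ _ ∷ p) t eq = Tokens-UDD-suffix ty k p t (∷-injectiveʳ (∷-injectiveʳ eq))

Tokens-noDownZig : Tokens y → ∀ k → ¬ HasDownZig (y ++ replicate k D)
Tokens-noDownZig ty k (1 , s≤s () , _)
Tokens-noDownZig ty k (suc (suc j) , _ , p , s , eq)
  with () ∷ [] ← ++⁻ʳ (replicate j D) (++⁻ˡ (replicate j D ++ U ∷ []) (Tokens-UDD-suffix ty k p _ eq))

NormalForm : ℝ → Word → Set
NormalForm c v = ∃₂ λ y k → Tokens y × Represents c v (y ++ replicate k D)

Represents-excess : 1≤ᵣ c → ∀ y k → Represents c v (y ++ replicate k D) → #D y + k ≤ #U y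
Represents-excess {c} 1≤c y k (_ , m) =
  subst₂ _≤_ (#D-++-replicate-D y k) (#U-++-replicate-D y k)
    (Rising[]⇒Rising {c} {y ++ replicate k D} 1≤c (𝓜⇒Rising[] {c} (y ++ replicate k D) m))

NormalForm-insertDU : 1≤ᵣ c → ∀ x z k → Tokens x → Tokens z → #U z ≡ #D z + k →
                      Represents c v ((x ++ U ∷ z) ++ replicate (suc k) D) → 𝓜[ c ] (v ∷ʳ U) →
                      NormalForm c (v ∷ʳ U)
NormalForm-insertDU {c} {v} 1≤c x z k tx tz balance rep mvU =
  x ++ U ∷ D ∷ U ∷ z , k , Tokens-++ tx (UD∷ U∷ tz) ,
  (λ i j → trans (new∼old i j) (old∼v i j)) ,
  subst 𝓜[ c ] (sym new≡)
    (𝓜-DU-insert {c} (x ∷ʳ U) zDᵏ 1≤c prefixRising balanced (subst 𝓜[ c ] old≡ (proj₂ rep)))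
  where
  zDᵏ = z ++ replicate k D
  old = (x ++ U ∷ z) ++ replicate (suc k) D
  balanced : #U zDᵏ ≡ #D zDᵏ
  balanced = trans (#U-++-replicate-D z k) (trans balance (sym (#D-++-replicate-D z k)))
  prefixRising : PrefixRising zDᵏ
  prefixRising = PrefixRising-++-replicate-D (Tokens⇒PrefixRising tz) (≤-reflexive (sym balance))
  old≡ : old ≡ (x ∷ʳ U) ++ zDᵏ ++ D ∷ []
  old≡ = begin
    (x ++ U ∷ z) ++ D ∷ replicate k D      ≡⟨ ++-assoc x (U ∷ z) _ ⟩
    x ++ U ∷ z ++ D ∷ replicate k D        ≡⟨ ∷ʳ-++ x U _ ⟨
    (x ∷ʳ U) ++ z ++ D ∷ replicate k D     ≡⟨ cong (λ r → (x ∷ʳ U) ++ z ++ r) (replicate-∷ʳ k D) ⟨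
    (x ∷ʳ U) ++ z ++ replicate k D ∷ʳ D    ≡⟨ cong ((x ∷ʳ U) ++_) (++-assoc z (replicate k D) _) ⟨
    (x ∷ʳ U) ++ zDᵏ ++ D ∷ []              ∎
    where open ≡-Reasoning
  old∷ʳU≡ : old ∷ʳ U ≡ (x ∷ʳ U) ++ zDᵏ ++ D ∷ U ∷ []
  old∷ʳU≡ = trans (cong (_∷ʳ U) old≡) (trans (++-assoc (x ∷ʳ U) _ _) (cong ((x ∷ʳ U) ++_) (++-assoc zDᵏ _ _)))
  new≡ : (x ++ U ∷ D ∷ U ∷ z) ++ replicate k D ≡ (x ∷ʳ U) ++ D ∷ U ∷ zDᵏ
  new≡ = trans (++-assoc x (U ∷ D ∷ U ∷ z) _) (sym (∷ʳ-++ x U _))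
  new∼old : ((x ++ U ∷ D ∷ U ∷ z) ++ replicate k D) ∼W (old ∷ʳ U)
  new∼old = subst₂ _∼W_ (sym new≡) (sym old∷ʳU≡) (∼W-DU-balanced (x ∷ʳ U) zDᵏ balanced)
  old∼v : (old ∷ʳ U) ∼W (v ∷ʳ U)
  old∼v = proj₁ (Represents-∷ʳ {c} {v} {old} U rep mvU)

NormalForm-∷ʳ : 1≤ᵣ c → ∀ l → NormalForm c v → 𝓜[ c ] (v ∷ʳ l) → NormalForm c (v ∷ʳ l)
NormalForm-∷ʳ {c} {v} 1≤c D (y , k , ty , rep) mvD =
  y , suc k , ty , subst (Represents c (v ∷ʳ D)) ∷ʳD≡ (Represents-∷ʳ {c} {v} D rep mvD)
  where
  ∷ʳD≡ : (y ++ replicate k D) ∷ʳ D ≡ y ++ replicate (suc k) D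
  ∷ʳD≡ = trans (++-assoc y _ _) (cong (y ++_) (replicate-∷ʳ k D))
NormalForm-∷ʳ {c} {v} 1≤c U (y , zero , ty , rep) mvU =
  y ∷ʳ U , 0 , Tokens-++ ty (U∷ []) , subst (Represents c (v ∷ʳ U)) ∷ʳU≡ (Represents-∷ʳ {c} {v} U rep mvU)
  where
  ∷ʳU≡ : (y ++ []) ∷ʳ U ≡ (y ∷ʳ U) ++ []
  ∷ʳU≡ = trans (cong (_∷ʳ U) (++-identityʳ y)) (sym (++-identityʳ _))
NormalForm-∷ʳ {c} {v} 1≤c U (y , suc k , ty , rep) mvU
  with x , z , refl , tx , tz , balance ← Tokens-split ty (Represents-excess {c} {v} 1≤c y (suc k) rep)
  = NormalForm-insertDU {c} {v} 1≤c x z k tx tz balance rep mvU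

normalForm : 1≤ᵣ c → ∀ v → 𝓜[ c ] v → NormalForm c v
normalForm {c} 1≤c v = go (reverseView v)
  where
  go : ∀ {v} → Reverse v → 𝓜[ c ] v → NormalForm c v
  go []            m = [] , 0 , [] , (λ _ _ → refl) , m
  go (v ∶ rv ∶ʳ l) m = NormalForm-∷ʳ {c} {v} 1≤c l (go rv (𝓜-++⁻ˡ {c} v m)) m

lemma6p8 : (c : ℝ) → 1≤ᵣ c → (w : Word) →
    (∃ λ v → (v ∼W w) × 𝓜[ c ] v) ⇔
    ((∀ v → v ∼W w → Rising v) × (∃ λ v → (v ∼W w) × UpNormal v × 𝓜[ c ] v))
lemma6p8 c 1≤c w = mk⇔ to from
  where
  to : (∃ λ v → (v ∼W w) × 𝓜[ c ] v) →
       (∀ v → v ∼W w → Rising v) × (∃ λ v → (v ∼W w) × UpNormal v × 𝓜[ c ] v)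
  to (v , v∼w , mv) with y , k , ty , n∼v , mn ← normalForm {c} 1≤c v mv =
    (λ u u∼w → 𝓜-∼W-Rising {c} 1≤c v mv u (λ i j → trans (v∼w i j) (sym (u∼w i j)))) ,
    (y ++ replicate k D , (λ i j → trans (n∼v i j) (v∼w i j)) ,
     (𝓜-∼W-Rising {c} 1≤c v mv (y ++ replicate k D) (λ i j → sym (n∼v i j)) , Tokens-noDownZig ty k) , mn)
  from : (∀ v → v ∼W w → Rising v) × (∃ λ v → (v ∼W w) × UpNormal v × 𝓜[ c ] v) →
         ∃ λ v → (v ∼W w) × 𝓜[ c ] v
  from (_ , v , v∼w , _ , mv) = v , v∼w , mv
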